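{- If the set of critical numbers is nonempty, then for every $i\in\{1,\dots,n\}$ and $j\in\{1,\dots,m\}$ we have $l_i\ne l'_j$ or $l_i=l'_j=0$. The second case only occurs for $n\equiv m\equiv1\bmod2$ with $i=\frac{n+1}{2}$, $j=\frac{m+1}{2}$.
   Context: For $N\ge1$ let $L_0^+(N)$ be the set of $(w,l)\in\mathbb{Z}\times\mathbb{Z}^N$ with $l_1>\dots>l_N$, $l_i+l_{N+1-i}=0$ and $w+l_i\equiv N+1\bmod2$. Fix $n,m\ge1$, $(w,l)\in L_0^+(n)$, $(w',l')\in L_0^+(m)$, $\delta,\delta'\in\{0,1\}$. In Knapp's notation for $W_{\mathbb{R}}$, $(l,t)$ ($l\ge1$) is irreducible $2$-dimensional and $(\mathrm{sgn}^\epsilon,t)$ is $1$-dimensional, $L(s,(l,t))=\Gamma_{\mathbb{C}}(s+t+\frac l2)$, $L(s,(\mathrm{sgn}^\epsilon,t))=\Gamma_{\mathbb{R}}(s+t+\epsilon)$, $\Gamma_{\mathbb{R}}(s)=\pi^{ -s/2}\Gamma(s/2)$, $\Gamma_{\mathbb{C}}(s)=2(2\pi)^{ -s}\Gamma(s)$; $L$-functions are multiplicative over irreducible constituents. $\pi_\infty^W=\bigoplus_{i\le n/2}(l_i,-w/2)$ plus $(\mathrm{sgn}^\delta,-w/2)$ if $n$ odd; $\sigma_\infty^W$ analogously; $\tau=\pi_\infty^W\otimes\sigma_\infty^W$, $\check\tau$ its contragredient. A number $t\in\frac{n+m}{2}+\mathbb{Z}$ is critical if neither $L(s,\tau)$ nor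 $L(1-s,\check\tau)$ has a pole at $s=t$. -}

module Defs where

open import Data.Nat as ℕ using (ℕ; zero; suc; _≡ᵇ_; _≤ᵇ_; ∣_-_∣; _%_)
open import Data.Integer as ℤ using (ℤ; +_; -_; _+_; _-_; _<_; 0ℤ)
open import Data.Integer.Divisibility using (_∣_)
open import Data.Fin using (Fin; toℕ; opposite)
open import Data.Bool using (Bool; true; false; if_then_else_; _xor_)
open import Data.List using (List; []; _∷_; _++_; concatMap; allFin)
open import Data.List.Relation.Unary.Any using (Any)
open import Data.Product using (_×_; ∃)
open import Relation.Binary.PropositionalEquality using (_≡_)
open import Relation.Nullary using (¬_)

-- CONVENTION: all "twists" t and the variable s are stored DOUBLED,
-- so that half-integers become integers:  T = 2t,  S = 2s.

-- The set L_0^+(N): (w,l) with l strictly decreasing, l_i + l_{N+1-i} = 0,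
-- and w + l_i ≡ N+1 mod 2.  Indices are 0-based (Fin N).
InL0+ : (N : ℕ) → ℤ → (Fin N → ℤ) → Set
InL0+ N w l =
  (∀ i j → toℕ i ℕ.< toℕ j → l j < l i) ×
  (∀ i → l i + l (opposite i) ≡ 0ℤ) ×
  (∀ i → (+ 2) ∣ (w + l i - + (N ℕ.+ 1)))

-- Irreducible representations of W_R in Knapp's notation.
--   twoDim l T  = (l, T/2)        (l ≥ 1)
--   oneDim ε T  = (sgn^ε, T/2)    (ε = false ↦ trivial, true ↦ sgn)
data Irr : Set where
  twoDim : ℕ → ℤ → Irr
  oneDim : Bool → ℤ → Irr

-- Tensor product of irreducibles, decomposed (Knapp):
--  (l,t)⊗(l',t') = (l+l',t+t') ⊕ (|l-l'|,t+t')          if l ≠ l'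
--                = (2l,t+t') ⊕ (1,t+t') ⊕ (sgn,t+t')     if l = l'
--  (l,t)⊗(sgn^ε,t') = (l,t+t'),  (sgn^ε,t)⊗(sgn^ε',t') = (sgn^{ε+ε'},t+t')
tensorIrr : Irr → Irr → List Irr
tensorIrr (twoDim a T) (twoDim b T') =
  if a ≡ᵇ b
  then twoDim (a ℕ.+ b) (T + T') ∷ oneDim false (T + T') ∷ oneDim true (T + T') ∷ []
  else twoDim (a ℕ.+ b) (T + T') ∷ twoDim ∣ a - b ∣ (T + T') ∷ []
tensorIrr (twoDim a T) (oneDim e T') = twoDim a (T + T') ∷ []
tensorIrr (oneDim e T) (twoDim b T') = twoDim b (T + T') ∷ []
tensorIrr (oneDim e T) (oneDim e' T') = oneDim (e xor e') (T + T') ∷ []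

tensor : List Irr → List Irr → List Irr
tensor τ σ = concatMap (λ a → concatMap (λ b → tensorIrr a b) σ) τ

dualIrr : Irr → Irr
dualIrr (twoDim a T) = twoDim a (- T)
dualIrr (oneDim e T) = oneDim e (- T)

dual : List Irr → List Irr
dual = Data.List.map dualIrr

-- π_∞^W = ⊕_{i ≤ n/2} (l_i, -w/2)  ⊕ (sgn^δ, -w/2) if n odd.
-- (1-based i ≤ n/2  ⇔  0-based i with 2·i+2 ≤ n; l_i > 0 there.)
piW : (N : ℕ) → ℤ → (Fin N → ℤ) → Bool → List Irr
piW N w l δ =
  concatMap (λ i → if (2 ℕ.* toℕ i ℕ.+ 2) ≤ᵇ N then twoDim ℤ.∣ l i ∣ (- w) ∷ [] else [])
            (allFin N)
  ++ (if N % 2 ≡ᵇ 1 then oneDim δ (- w) ∷ [] else [])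

bit : Bool → ℤ
bit false = + 0
bit true  = + 1

-- L(s, ρ) has a pole at s = S/2, for ρ irreducible:
--   Γ_C(x) has poles at x ∈ {0,-1,-2,…};  x = s + t + l/2, i.e. 2x = S + T + l.
--   Γ_R(x) has poles at x ∈ {0,-2,-4,…};  x = s + t + ε,   i.e. 2x = S + T + 2ε.
PoleIrr : ℤ → Irr → Set
PoleIrr S (twoDim a T) = ∃ λ (k : ℕ) → S + T + + a ≡ - (+ (2 ℕ.* k))
PoleIrr S (oneDim e T) = ∃ λ (k : ℕ) → S + T + (+ 2) ℤ.* bit e ≡ - (+ (4 ℕ.* k))

-- L-functions are products of Gamma factors (no zeros), so L(s,τ)
-- has a pole iff one of the factors does.
PoleL : ℤ → List Irr → Set
PoleL S τ = Any (PoleIrr S) τ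

-- s = S/2 is critical for τ: s ∈ (n+m)/2 + ℤ, and neither L(s,τ) nor
-- L(1-s,τ̌) has a pole (2(1-s) = 2 - S).
Critical : ℕ → ℕ → List Irr → ℤ → Set
Critical n m τ S =
  (+ 2) ∣ (S - + (n ℕ.+ m)) × ¬ PoleL S τ × ¬ PoleL (+ 2 - S) (dual τ)

-- Suppose l i = l' j ≠ 0. Reflecting through l (opposite i) = - l i, both π and σ contain the
-- constituent (|l i|, ·), so τ contains (1, t) ⊕ (sgn, t) with t = -(w + w')/2. The parity conditions
-- in L₀⁺ and in the definition of critical numbers make s + t an integer x, and for every integer x one
-- of Γℝ(x), Γℝ(x + 1), Γℝ(1 - x), Γℝ(2 - x) has a pole; hence no s is critical. If l i = l' j = 0,
-- strict monotonicity and l (opposite i) = - l i force i to be the middle index, and likewise j.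
module Submission where

open import Defs
open import Data.Bool using (Bool; true; false; T; if_then_else_)
open import Data.Bool.Properties using (T-≡)
open import Data.Empty using (⊥-elim)
open import Data.Fin using (Fin; toℕ; opposite)
open import Data.Fin.Properties using (opposite-prop; opposite-involutive; toℕ<n; toℕ-injective)
open import Data.Integer as ℤ using (ℤ; +_; -_; -[1+_]; 0ℤ)
import Data.Integer.Properties as ℤ
open import Algebra.Properties.AbelianGroup ℤ.+-0-abelianGroup using (inverseʳ-unique)
open import Data.Integer.Divisibility using (_∣_)
open import Data.Integer.Divisibility.Signed using (divides; ∣ᵤ⇒∣; ∣-refl; ∣m∣n⇒∣m+n; ∣m∣n⇒∣m-n; ∣n⇒∣m*n)
  renaming (_∣_ to _∣ˢ_)
open import Data.List using ([]; _∷_)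
open import Data.List.Membership.Propositional using (_∈_; lose)
open import Data.List.Membership.Propositional.Properties using (∈-++⁺ˡ; ∈-concatMap⁺; ∈-allFin; ∈-map⁺)
open import Data.List.Relation.Unary.Any as Any using (here; there)
open import Data.Nat as ℕ using (ℕ; zero; suc)
import Data.Nat.Properties as ℕ
open import Data.Product using (Σ; ∃; ∃₂; _×_; _,_; proj₁; proj₂)
open import Data.Sum as Sum using (_⊎_; inj₁; inj₂; [_,_]′)
open import Function.Bundles using (Equivalence)
open import Relation.Binary.Definitions using (tri<; tri≈; tri>)
open import Relation.Binary.PropositionalEquality using (_≡_; _≢_; refl; sym; trans; cong; subst; module ≡-Reasoning)
open import Relation.Nullary using (yes; no)

module _ where
  open import Data.Integer using (_+_; _-_; _*_)
  open import Data.Integer.Tactic.RingSolver using (solve-∀)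
  open ≡-Reasoning

  neg-double-ΓℝPole : ∀ p → ∃₂ λ e k → - (+ (2 ℕ.* p)) + + 2 * bit e ≡ - (+ (4 ℕ.* k))
  neg-double-ΓℝPole 0 = false , 0 , refl
  neg-double-ΓℝPole 1 = true , 0 , refl
  neg-double-ΓℝPole (suc (suc p)) with neg-double-ΓℝPole p
  ... | e , k , pole = e , suc k , (begin
    - (+ (2 ℕ.* suc (suc p))) + + 2 * bit e
      ≡⟨ cong (λ x → - (+ x) + + 2 * bit e) (trans (ℕ.*-suc 2 (suc p)) (cong (2 ℕ.+_) (ℕ.*-suc 2 p))) ⟩
    - (+ 2 + (+ 2 + + (2 ℕ.* p))) + + 2 * bit e
      ≡⟨ shift₁ (+ (2 ℕ.* p)) (+ 2 * bit e) ⟩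
    (- (+ (2 ℕ.* p)) + + 2 * bit e) - + 4
      ≡⟨ cong (_- + 4) pole ⟩
    - (+ (4 ℕ.* k)) - + 4
      ≡⟨ shift₂ (+ (4 ℕ.* k)) ⟩
    - (+ 4 + + (4 ℕ.* k))
      ≡⟨ cong (λ x → - (+ x)) (ℕ.*-suc 4 k) ⟨
    - (+ (4 ℕ.* suc k)) ∎)
    where
    shift₁ : ∀ X B → - (+ 2 + (+ 2 + X)) + B ≡ (- X + B) - + 4
    shift₁ = solve-∀
    shift₂ : ∀ X → - X - + 4 ≡ - (+ 4 + X)
    shift₂ = solve-∀

  neg-double⇒ΓℝPole : ∀ S T p → S + T ≡ - (+ (2 ℕ.* p)) → Σ Bool λ e → PoleIrr S (oneDim e T)
  neg-double⇒ΓℝPole S T p S+T≡-2p with neg-double-ΓℝPole p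
  ... | e , k , pole = e , k , trans (cong (_+ + 2 * bit e) S+T≡-2p) pole

  -- With S + T = 2q, the factor at s has a pole when q ≤ 0 and the dual factor at 1 - s when q ≥ 1.
  even⇒ΓℝPole-or-dual : ∀ S T → + 2 ∣ˢ S + T →
    (Σ Bool λ e → PoleIrr S (oneDim e T)) ⊎ (Σ Bool λ e → PoleIrr (+ 2 - S) (oneDim e (- T)))
  even⇒ΓℝPole-or-dual S T (divides (+ 0) S+T≡0) = inj₁ (neg-double⇒ΓℝPole S T 0 S+T≡0)
  even⇒ΓℝPole-or-dual S T (divides (+ suc p) S+T≡2+2p) = inj₂ (neg-double⇒ΓℝPole (+ 2 - S) (- T) p (begin
    + 2 - S + - T           ≡⟨ dual-sum S T ⟩
    + 2 - (S + T)           ≡⟨ cong (λ x → + 2 - x) S+T≡2+2p ⟩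
    + 2 - (+ 1 + + p) * + 2 ≡⟨ two-minus-double-suc (+ p) ⟩
    - (+ 2 * + p)           ≡⟨ cong -_ (ℤ.pos-* 2 p) ⟨
    - (+ (2 ℕ.* p))         ∎))
    where
    dual-sum : ∀ S T → + 2 - S + - T ≡ + 2 - (S + T)
    dual-sum = solve-∀
    two-minus-double-suc : ∀ P → + 2 - (+ 1 + P) * + 2 ≡ - (+ 2 * P)
    two-minus-double-suc = solve-∀
  even⇒ΓℝPole-or-dual S T (divides -[1+ p ] S+T≡-2-2p) = inj₁ (neg-double⇒ΓℝPole S T (suc p) (begin
    S + T                   ≡⟨ S+T≡-2-2p ⟩
    - (+ 1 + + p) * + 2     ≡⟨ neg-suc-double (+ p) ⟩
    - (+ 2 * (+ 1 + + p))   ≡⟨ cong -_ (ℤ.pos-* 2 (suc p)) ⟨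
    - (+ (2 ℕ.* suc p))     ∎))
    where
    neg-suc-double : ∀ P → - (+ 1 + P) * + 2 ≡ - (+ 2 * (+ 1 + P))
    neg-suc-double = solve-∀

  oneDim∈tensorIrr-twoDim² : ∀ a T T' e → oneDim e (T + T') ∈ tensorIrr (twoDim a T) (twoDim a T')
  oneDim∈tensorIrr-twoDim² a T T' e rewrite Equivalence.to T-≡ (ℕ.≡⇒≡ᵇ a a refl) with e
  ... | false = there (here refl)
  ... | true  = there (there (here refl))

  ∈-tensor : ∀ {x y z τ σ} → x ∈ τ → y ∈ σ → z ∈ tensorIrr x y → z ∈ tensor τ σ
  ∈-tensor x∈τ y∈σ z∈xy =
    ∈-concatMap⁺ _ (Any.map (λ { refl → ∈-concatMap⁺ _ (Any.map (λ { refl → z∈xy }) y∈σ) }) x∈τ)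

  common-twoDim⇒pole : ∀ {a T T' τ σ} S → twoDim a T ∈ τ → twoDim a T' ∈ σ → + 2 ∣ˢ S + (T + T') →
    PoleL S (tensor τ σ) ⊎ PoleL (+ 2 - S) (dual (tensor τ σ))
  common-twoDim⇒pole {a} {T} {T'} {τ} {σ} S a∈τ a∈σ even =
    Sum.map (λ (e , pole) → lose (oneDim∈τσ e) pole)
            (λ (e , pole) → lose (∈-map⁺ dualIrr (oneDim∈τσ e)) pole)
            (even⇒ΓℝPole-or-dual S (T + T') even)
    where
    oneDim∈τσ : ∀ e → oneDim e (T + T') ∈ tensor τ σ
    oneDim∈τσ e = ∈-tensor a∈τ a∈σ (oneDim∈tensorIrr-twoDim² a T T' e)

  tensor-twist-parity : ∀ S w w' x n m → + 2 ∣ S - + (n ℕ.+ m) →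
    + 2 ∣ w + x - + (n ℕ.+ 1) → + 2 ∣ w' + x - + (m ℕ.+ 1) → + 2 ∣ˢ S + (- w + - w')
  tensor-twist-parity S w w' x n m S-parity w-parity w'-parity =
    subst (+ 2 ∣ˢ_) (regroup S w w' x (+ n) (+ m))
      (∣m∣n⇒∣m+n (∣m∣n⇒∣m-n (∣m∣n⇒∣m-n S-parityˢ w-parityˢ) w'-parityˢ) (∣n⇒∣m*n (x - + 1) ∣-refl))
    where
    S-parityˢ : + 2 ∣ˢ S - + (n ℕ.+ m)
    S-parityˢ = ∣ᵤ⇒∣ S-parity
    w-parityˢ : + 2 ∣ˢ w + x - + (n ℕ.+ 1)
    w-parityˢ = ∣ᵤ⇒∣ w-parity
    w'-parityˢ : + 2 ∣ˢ w' + x - + (m ℕ.+ 1)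
    w'-parityˢ = ∣ᵤ⇒∣ w'-parity
    regroup : ∀ S w w' x N M →
      S - (N + M) - (w + x - (N + + 1)) - (w' + x - (M + + 1)) + (x - + 1) * + 2 ≡ S + (- w + - w')
    regroup = solve-∀

open import Data.Nat using (_≤_; _<_; _+_; _*_)
open import Data.Nat.Tactic.RingSolver using (solve-∀)

suc-toℕ+toℕ-opposite : ∀ {n} (i : Fin n) → suc (toℕ i) + toℕ (opposite i) ≡ n
suc-toℕ+toℕ-opposite i = trans (cong (λ x → suc (toℕ i) + x) (opposite-prop i)) (ℕ.m+[n∸m]≡n (toℕ<n i))

toℕ<toℕ-opposite⇒lower-half : ∀ {n} (i : Fin n) → toℕ i < toℕ (opposite i) → 2 * toℕ i + 2 ≤ n
toℕ<toℕ-opposite⇒lower-half {n} i i<o = begin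
  2 * toℕ i + 2                   ≡⟨ double-suc (toℕ i) ⟩
  suc (toℕ i) + suc (toℕ i)       ≤⟨ ℕ.+-monoʳ-≤ (suc (toℕ i)) i<o ⟩
  suc (toℕ i) + toℕ (opposite i)  ≡⟨ suc-toℕ+toℕ-opposite i ⟩
  n                               ∎
  where
  open ℕ.≤-Reasoning
  double-suc : ∀ x → 2 * x + 2 ≡ suc x + suc x
  double-suc = solve-∀

toℕ≡toℕ-opposite⇒middle : ∀ {n} (i : Fin n) → toℕ i ≡ toℕ (opposite i) → 2 * toℕ i + 1 ≡ n
toℕ≡toℕ-opposite⇒middle {n} i i≡o = begin
  2 * toℕ i + 1                   ≡⟨ double+1 (toℕ i) ⟩
  suc (toℕ i) + toℕ i             ≡⟨ cong (λ x → suc (toℕ i) + x) i≡o ⟩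
  suc (toℕ i) + toℕ (opposite i)  ≡⟨ suc-toℕ+toℕ-opposite i ⟩
  n                               ∎
  where
  open ≡-Reasoning
  double+1 : ∀ x → 2 * x + 1 ≡ suc x + x
  double+1 = solve-∀

∈-if-true : ∀ {b} {x : Irr} → T b → x ∈ (if b then x ∷ [] else [])
∈-if-true {true} _ = here refl

lower-half⇒twoDim∈piW : ∀ {N} w (l : Fin N → ℤ) δ i → 2 * toℕ i + 2 ≤ N → twoDim ℤ.∣ l i ∣ (- w) ∈ piW N w l δ
lower-half⇒twoDim∈piW w l δ i lower =
  ∈-++⁺ˡ (∈-concatMap⁺ _ (Any.map (λ { refl → ∈-if-true (ℕ.≤⇒≤ᵇ lower) }) (∈-allFin i)))

self-negative⇒0 : ∀ x → x ≡ - x → x ≡ 0ℤ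
self-negative⇒0 (+ zero)  _ = refl
self-negative⇒0 (+ suc _) ()
self-negative⇒0 -[1+ _ ]  ()

module _ {N} (w : ℤ) (l : Fin N → ℤ) (hl : InL0+ N w l) where

  opposite-weight : ∀ i → l (opposite i) ≡ - l i
  opposite-weight i = inverseʳ-unique (l i) _ (proj₁ (proj₂ hl) i)

  weight-injective : ∀ {i j} → l i ≡ l j → toℕ i ≡ toℕ j
  weight-injective {i} {j} li≡lj with ℕ.<-cmp (toℕ i) (toℕ j)
  ... | tri< i<j _ _ = ⊥-elim (ℤ.<-irrefl (sym li≡lj) (proj₁ hl i j i<j))
  ... | tri≈ _ i≡j _ = i≡j
  ... | tri> _ _ j<i = ⊥-elim (ℤ.<-irrefl li≡lj (proj₁ hl j i j<i))

  weight≡0⇒middle : ∀ i → l i ≡ 0ℤ → 2 * toℕ i + 1 ≡ N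
  weight≡0⇒middle i li≡0 =
    toℕ≡toℕ-opposite⇒middle i (weight-injective (trans li≡0 (sym (trans (opposite-weight i) (cong -_ li≡0)))))

  twoDim-∣weight∣∈piW : ∀ δ i → l i ≢ 0ℤ → twoDim ℤ.∣ l i ∣ (- w) ∈ piW N w l δ
  twoDim-∣weight∣∈piW δ i li≢0 with ℕ.<-cmp (toℕ i) (toℕ (opposite i))
  ... | tri< i<o _ _ = lower-half⇒twoDim∈piW w l δ i (toℕ<toℕ-opposite⇒lower-half i i<o)
  ... | tri≈ _ i≡o _ =
    ⊥-elim (li≢0 (self-negative⇒0 (l i) (trans (cong l (toℕ-injective i≡o)) (opposite-weight i))))
  ... | tri> _ _ o<i =
    subst (λ a → twoDim a (- w) ∈ piW N w l δ)
          (trans (cong ℤ.∣_∣ (opposite-weight i)) (ℤ.∣-i∣≡∣i∣ (l i)))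
          (lower-half⇒twoDim∈piW w l δ (opposite i)
            (toℕ<toℕ-opposite⇒lower-half (opposite i)
              (subst (toℕ (opposite i) <_) (cong toℕ (sym (opposite-involutive i))) o<i)))

proposition2p2 : (n m : ℕ) → 1 ≤ n → 1 ≤ m →
    (w : ℤ) (l : Fin n → ℤ) → InL0+ n w l →
    (w' : ℤ) (l' : Fin m → ℤ) → InL0+ m w' l' →
    (δ δ' : Bool) →
    ∃ (λ S → Critical n m (tensor (piW n w l δ) (piW m w' l' δ')) S) →
    (i : Fin n) (j : Fin m) →
      (l i ≢ l' j)
      ⊎ (l i ≡ 0ℤ × l' j ≡ 0ℤ × 2 * toℕ i + 1 ≡ n × 2 * toℕ j + 1 ≡ m)
proposition2p2 n m _ _ w l hl w' l' hl' δ δ' (S , S-parity , no-pole , no-dual-pole) i j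
  with l i ℤ.≟ l' j | l i ℤ.≟ 0ℤ
... | no li≢l'j | _ = inj₁ li≢l'j
... | yes li≡l'j | yes li≡0 =
  inj₂ (li≡0 , l'j≡0 , weight≡0⇒middle w l hl i li≡0 , weight≡0⇒middle w' l' hl' j l'j≡0)
  where
  l'j≡0 : l' j ≡ 0ℤ
  l'j≡0 = trans (sym li≡l'j) li≡0
... | yes li≡l'j | no li≢0 =
  ⊥-elim ([ no-pole , no-dual-pole ]′ (common-twoDim⇒pole S l∈π l∈σ twist-parity))
  where
  l∈π : twoDim ℤ.∣ l i ∣ (- w) ∈ piW n w l δ
  l∈π = twoDim-∣weight∣∈piW w l hl δ i li≢0
  l∈σ : twoDim ℤ.∣ l i ∣ (- w') ∈ piW m w' l' δ'
  l∈σ = subst (λ x → twoDim ℤ.∣ x ∣ (- w') ∈ piW m w' l' δ') (sym li≡l'j)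
              (twoDim-∣weight∣∈piW w' l' hl' δ' j (λ l'j≡0 → li≢0 (trans li≡l'j l'j≡0)))
  w'-parity : + 2 ∣ w' ℤ.+ l i ℤ.- + (m + 1)
  w'-parity = subst (λ x → + 2 ∣ w' ℤ.+ x ℤ.- + (m + 1)) (sym li≡l'j) (proj₂ (proj₂ hl') j)
  twist-parity : + 2 ∣ˢ S ℤ.+ (- w ℤ.+ - w')
  twist-parity = tensor-twist-parity S w w' (l i) n m S-parity (proj₂ (proj₂ hl) i) w'-parity
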